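{- Fix integers $k \ge 3$ and $i \in \{2,\dots,k-1\}$. Let $d \ge 1$ and let $X \subset \mathbb{Z}_k^d$ be a hole in $\mathbb{Z}_k^d$. Then for each $x \in X$ the set $(X \setminus \{x\})^{\dagger}$ is a hole in $\mathbb{Z}_k^{d+1}$.
   Context: $\mathbb{Z}_k$ denotes the integers modulo $k$. Let $T = \{1,\dots,k\}\setminus\{i\}$, identified with its image in $\mathbb{Z}_k$. A copy of $T$ in $\mathbb{Z}_k^d$ is a set $\{y + t e_j : t \in \mathbb{Z}_k,\ t\neq a\}$ with $y \in \mathbb{Z}_k^d$, $j \in \{1,\dots,d\}$, $a \in \mathbb{Z}_k$ (a coordinate line with one point removed). A set $X \subset \mathbb{Z}_k^d$ is a hole in $\mathbb{Z}_k^d$ if $\mathbb{Z}_k^d\setminus X$ is a disjoint union of copies of $T$. For $1\le j\le d$ the $j$-th corner is $c_{j,d} = (k-1)e_j \in \mathbb{Z}_k^d$ (all coordinates $0$ except the $j$-th, which is $k-1$). For $S \subset \mathbb{Z}_k^d$ define $S^{\dagger} = (S \times \{0\}) \cup \{c_{d+1,d+1}\} \subset \mathbb{Z}_k^{d+1}$. -}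

module Defs where

open import Data.Nat using (ℕ; _∸_; NonZero)
open import Data.Nat.DivMod using (_mod_)
open import Data.Fin using (Fin; toℕ)
open import Data.Vec using (Vec; replicate; _∷ʳ_; updateAt; lookup)
open import Data.Product using (Σ; ∃; _×_)
open import Relation.Binary.PropositionalEquality using (_≡_)
open import Relation.Nullary using (¬_)

ℤ_ : (k : ℕ) → Set
ℤ k = Fin k

_⊕_ : {k : ℕ} .{{_ : NonZero k}} → Fin k → Fin k → Fin k
_⊕_ {k} a b = (toℕ a Data.Nat.+ toℕ b) mod k

Point : (k d : ℕ) → Set
Point k d = Vec (Fin k) d

Subset : (k d : ℕ) → Set₁
Subset k d = Point k d → Set

shift : {k d : ℕ} .{{_ : NonZero k}} → Point k d → Fin d → Fin k → Point k d
shift y j t = updateAt y j (λ c → c ⊕ t)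

-- A copy of T = ℤ_k \ {i}: the set { y + t e_j : t ∈ ℤ_k, t ≠ a }
record Copy (k d : ℕ) : Set where
  constructor copy
  field
    base : Point k d
    dir  : Fin d
    gap  : Fin k

InCopy : {k d : ℕ} .{{_ : NonZero k}} → Copy k d → Point k d → Set
InCopy {k} (copy y j a) p = Σ (Fin k) λ t → (¬ t ≡ a) × (p ≡ shift y j t)

-- X is a hole in ℤ_k^d: the complement of X is a disjoint union of
-- (finitely many; ℤ_k^d is finite) copies of T, given as an indexed family C.
IsHole : (k d : ℕ) .{{_ : NonZero k}} → Subset k d → Set
IsHole k d X =
  Σ ℕ λ m → Σ (Fin m → Copy k d) λ C →
    ((p : Point k d) → X p → (r : Fin m) → ¬ InCopy (C r) p)
  × ((p : Point k d) → ¬ X p → ∃ λ r → InCopy (C r) p)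
  × ((p : Point k d) (r s : Fin m) → InCopy (C r) p → InCopy (C s) p → r ≡ s)

zeroℤ : (k : ℕ) .{{_ : NonZero k}} → Fin k
zeroℤ k = 0 mod k

topℤ : (k : ℕ) .{{_ : NonZero k}} → Fin k
topℤ k = (k ∸ 1) mod k

lastCorner : (k d : ℕ) .{{_ : NonZero k}} → Point k (Data.Nat.suc d)
lastCorner k d = replicate d (zeroℤ k) ∷ʳ topℤ k

dagger : (k d : ℕ) .{{_ : NonZero k}} → Subset k d → Subset k (Data.Nat.suc d)
dagger k d S p =
  (Σ (Point k d) λ q → S q × (p ≡ q ∷ʳ zeroℤ k)) Data.Sum.⊎ (p ≡ lastCorner k d)
  where import Data.Sum

remove : {k d : ℕ} → Subset k d → Point k d → Subset k d
remove X x q = X q × ¬ q ≡ x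

module Submission where

-- Write Y = (X ∖ {x})† and p = q ∷ʳ l for a point of ℤ_k^{d+1}
-- (q ∈ ℤ_k^d, l the new last coordinate, the "level").  The complement of Y
-- is the disjoint union of
--   * the vertical line over x with its top point (x, k-1) removed — one copy;
--   * the complement of X at level 0 — the copies tiling it, lifted;
--   * at each level l ≠ 0 the level minus one point: minus x if l ≠ k-1 and
--     minus 0 (the corner c_{d+1,d+1} ∈ Y) if l = k-1.
-- A punctured space ℤ_k^d ∖ {a} is itself a disjoint union of copies
-- (induction on d: the vertical lines off level a_last, plus the punctured
-- space at level a_last), so each piece is tiled and so is their union.

open import Defs
open import Data.Nat using (ℕ; zero; suc; _≤_; _∸_; _+_; _*_; _%_; NonZero; s≤s; z≤n; >-nonZero⁻¹)
open import Data.Nat.DivMod using (m<n⇒m%n≡m)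
open import Data.Nat.Properties using (<⇒≢; n<1+n)
open import Data.Fin as Fin using (Fin; toℕ; inject₁; fromℕ)
open import Data.Fin.Properties using (toℕ-injective; toℕ-fromℕ<; toℕ<n; suc-injective; 0↔⊥; 1↔⊤; +↔⊎; *↔×)
open import Data.Vec using (Vec; []; _∷_; _∷ʳ_; replicate; initLast)
open import Data.Vec.Properties using (∷ʳ-injective; ∷ʳ-injectiveˡ; ∷ʳ-injectiveʳ; ≡-dec)
open import Data.Product using (Σ; ∃; _×_; _,_; proj₁)
open import Data.Sum using (_⊎_; inj₁; inj₂)
open import Data.Unit using (⊤; tt)
open import Data.Empty using (⊥; ⊥-elim)
open import Function.Bundles using (_↔_; mk↔ₛ′; Inverse)
open import Function.Properties.Inverse using (↔-trans; ↔-sym; ↔-refl)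
open import Data.Sum.Function.Propositional using (_⊎-↔_)
open import Data.Product.Function.NonDependent.Propositional using (_×-↔_)
open import Relation.Binary.PropositionalEquality using (_≡_; refl; sym; trans; cong; cong₂; subst; module ≡-Reasoning)
open import Relation.Nullary using (¬_; Dec; yes; no)

Finite : Set → Set
Finite A = Σ ℕ λ n → A ↔ Fin n

finite-↔ : {A B : Set} → A ↔ B → Finite B → Finite A
finite-↔ e (n , f) = n , ↔-trans e f

finite-⊥ : Finite ⊥
finite-⊥ = 0 , ↔-sym 0↔⊥

finite-⊤ : Finite ⊤
finite-⊤ = 1 , ↔-sym 1↔⊤

finite-Fin : (n : ℕ) → Finite (Fin n)
finite-Fin n = n , ↔-refl

finite-⊎ : {A B : Set} → Finite A → Finite B → Finite (A ⊎ B)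
finite-⊎ (m , e) (n , f) = m + n , ↔-trans (e ⊎-↔ f) (↔-sym +↔⊎)

finite-× : {A B : Set} → Finite A → Finite B → Finite (A × B)
finite-× (m , e) (n , f) = m * n , ↔-trans (e ×-↔ f) (↔-sym *↔×)

finite-Vec : {A : Set} → Finite A → (d : ℕ) → Finite (Vec A d)
finite-Vec A-fin zero = finite-↔ (mk↔ₛ′ (λ _ → tt) (λ _ → []) (λ _ → refl) (λ { [] → refl })) finite-⊤
finite-Vec A-fin (suc d) = finite-↔ uncons (finite-× A-fin (finite-Vec A-fin d))
  where
  uncons : Vec _ (suc d) ↔ (_ × Vec _ d)
  uncons = mk↔ₛ′ (λ { (a ∷ v) → a , v }) (λ (a , v) → a ∷ v) (λ _ → refl) (λ { (a ∷ v) → refl })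

module _ {k : ℕ} .{{_ : NonZero k}} where

  zero-⊕ : (t : Fin k) → zeroℤ k ⊕ t ≡ t
  zero-⊕ t = toℕ-injective (begin
      toℕ (zeroℤ k ⊕ t)             ≡⟨ toℕ-fromℕ< _ ⟩
      (toℕ (zeroℤ k) + toℕ t) % k   ≡⟨ cong (λ n → (n + toℕ t) % k) toℕ-zero ⟩
      toℕ t % k                      ≡⟨ m<n⇒m%n≡m (toℕ<n t) ⟩
      toℕ t                          ∎)
    where
    open ≡-Reasoning
    toℕ-zero : toℕ (zeroℤ k) ≡ 0
    toℕ-zero = trans (toℕ-fromℕ< _) (m<n⇒m%n≡m (>-nonZero⁻¹ k))

  shift-inject : ∀ {d} (y : Point k d) (j : Fin d) (z t : Fin k) →
                 shift (y ∷ʳ z) (inject₁ j) t ≡ shift y j t ∷ʳ z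
  shift-inject (a ∷ y) Fin.zero    z t = refl
  shift-inject (a ∷ y) (Fin.suc j) z t = cong (a ∷_) (shift-inject y j z t)

  shift-last : ∀ {d} (y : Point k d) (z t : Fin k) → shift (y ∷ʳ z) (fromℕ d) t ≡ y ∷ʳ (z ⊕ t)
  shift-last []      z t = refl
  shift-last (a ∷ y) z t = cong (a ∷_) (shift-last y z t)

  AtLevel : ∀ {d} → Fin k → Subset k d → Subset k (suc d)
  AtLevel z R p = Σ (Point k _) λ q → R q × p ≡ q ∷ʳ z

  Column : ∀ {d} → Point k d → Fin k → Subset k (suc d)
  Column q g p = Σ (Fin k) λ t → ¬ t ≡ g × p ≡ q ∷ʳ t

  liftCopy : ∀ {d} → Fin k → Copy k d → Copy k (suc d)
  liftCopy z (copy y j g) = copy (y ∷ʳ z) (inject₁ j) g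

  column : ∀ {d} → Point k d → Fin k → Copy k (suc d)
  column {d} q g = copy (q ∷ʳ zeroℤ k) (fromℕ d) g

  liftCopy⊆ : ∀ {d} z (c : Copy k d) p → InCopy (liftCopy z c) p → AtLevel z (InCopy c) p
  liftCopy⊆ z (copy y j g) p (t , t≢g , refl) = shift y j t , (t , t≢g , refl) , shift-inject y j z t

  liftCopy⊇ : ∀ {d} z (c : Copy k d) p → AtLevel z (InCopy c) p → InCopy (liftCopy z c) p
  liftCopy⊇ z (copy y j g) p (q , (t , t≢g , refl) , refl) = t , t≢g , sym (shift-inject y j z t)

  shift-column : ∀ {d} (q : Point k d) (t : Fin k) → shift (q ∷ʳ zeroℤ k) (fromℕ d) t ≡ q ∷ʳ t
  shift-column q t = trans (shift-last q _ t) (cong (q ∷ʳ_) (zero-⊕ t))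

  column⊆ : ∀ {d} (q : Point k d) g p → InCopy (column q g) p → Column q g p
  column⊆ q g p (t , t≢g , refl) = t , t≢g , shift-column q t

  column⊇ : ∀ {d} (q : Point k d) g p → Column q g p → InCopy (column q g) p
  column⊇ q g p (t , t≢g , refl) = t , t≢g , sym (shift-column q t)

  record Tiling {d : ℕ} (R : Subset k d) (J : Set) : Set where
    field
      tile   : J → Copy k d
      inside : ∀ j p → InCopy (tile j) p → R p
      cover  : ∀ p → R p → ∃ λ j → InCopy (tile j) p
      unique : ∀ p j j′ → InCopy (tile j) p → InCopy (tile j′) p → j ≡ j′

  open Tiling

  retile : ∀ {d} {R S : Subset k d} {J} → (∀ p → R p → S p) → (∀ p → S p → R p) → Tiling R J → Tiling S J
  retile R⊆S S⊆R T = record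
    { tile   = tile T
    ; inside = λ j p m → R⊆S p (inside T j p m)
    ; cover  = λ p s → cover T p (S⊆R p s)
    ; unique = unique T
    }

  reindex : ∀ {d} {R : Subset k d} {J K : Set} → J ↔ K → Tiling R J → Tiling R K
  reindex e T = record
    { tile   = λ j → tile T (from j)
    ; inside = λ j → inside T (from j)
    ; cover  = λ p r → let (j , m) = cover T p r in
                 to j , subst (λ i → InCopy (tile T i) p) (sym (strictlyInverseʳ j)) m
    ; unique = λ p j j′ m m′ → begin
        j                ≡⟨ sym (strictlyInverseˡ j) ⟩
        to (from j)      ≡⟨ cong to (unique T p (from j) (from j′) m m′) ⟩
        to (from j′)     ≡⟨ strictlyInverseˡ j′ ⟩
        j′               ∎
    }
    where open Inverse e
          open ≡-Reasoning

  tiling-∪ : ∀ {d} {R S : Subset k d} {J K} → (∀ p → R p → S p → ⊥) →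
             Tiling R J → Tiling S K → Tiling (λ p → R p ⊎ S p) (J ⊎ K)
  tiling-∪ {R = R} {S} {J} {K} disjoint T U = record
    { tile = tile′ ; inside = inside′ ; cover = cover′ ; unique = unique′ }
    where
    tile′ : J ⊎ K → Copy k _
    tile′ (inj₁ j) = tile T j
    tile′ (inj₂ j) = tile U j

    inside′ : ∀ j p → InCopy (tile′ j) p → R p ⊎ S p
    inside′ (inj₁ j) p m = inj₁ (inside T j p m)
    inside′ (inj₂ j) p m = inj₂ (inside U j p m)

    cover′ : ∀ p → R p ⊎ S p → ∃ λ j → InCopy (tile′ j) p
    cover′ p (inj₁ r) = let (j , m) = cover T p r in inj₁ j , m
    cover′ p (inj₂ s) = let (j , m) = cover U p s in inj₂ j , m

    unique′ : ∀ p j j′ → InCopy (tile′ j) p → InCopy (tile′ j′) p → j ≡ j′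
    unique′ p (inj₁ j) (inj₁ j′) m m′ = cong inj₁ (unique T p j j′ m m′)
    unique′ p (inj₁ j) (inj₂ j′) m m′ = ⊥-elim (disjoint p (inside T j p m) (inside U j′ p m′))
    unique′ p (inj₂ j) (inj₁ j′) m m′ = ⊥-elim (disjoint p (inside T j′ p m′) (inside U j p m))
    unique′ p (inj₂ j) (inj₂ j′) m m′ = cong inj₂ (unique U p j j′ m m′)

  tiling-lift : ∀ {d} {R : Subset k d} {J} (z : Fin k) → Tiling R J → Tiling (AtLevel z R) J
  tiling-lift z T = record
    { tile   = λ j → liftCopy z (tile T j)
    ; inside = λ j p m → let (q , m′ , p≡q∷z) = liftCopy⊆ z (tile T j) p m in
                 q , inside T j q m′ , p≡q∷z
    ; cover  = λ { p (q , r , refl) → let (j , m) = cover T q r in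
                   j , liftCopy⊇ z (tile T j) p (q , m , refl) }
    ; unique = unique′
    }
    where
    unique′ : ∀ p j j′ → InCopy (liftCopy z (tile T j)) p → InCopy (liftCopy z (tile T j′)) p → j ≡ j′
    unique′ p j j′ m m′ with liftCopy⊆ z (tile T j) p m | liftCopy⊆ z (tile T j′) p m′
    ... | q , c , refl | q′ , c′ , e with ∷ʳ-injectiveˡ q q′ e
    ... | refl = unique T q j j′ c c′

  tiling-levels : ∀ {d} {L J : Set} {R : L → Subset k d} (level : L → Fin k) →
                  (∀ {s s′} → level s ≡ level s′ → s ≡ s′) → ((s : L) → Tiling (R s) J) →
                  Tiling (λ p → Σ L λ s → AtLevel (level s) (R s) p) (L × J)
  tiling-levels {L = L} {J} {R} level level-injective T = record
    { tile = tile′ ; inside = inside′ ; cover = cover′ ; unique = unique′ }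
    where
    tile′ : L × J → Copy k _
    tile′ (s , j) = liftCopy (level s) (tile (T s) j)

    inside′ : ∀ i p → InCopy (tile′ i) p → Σ L λ s → AtLevel (level s) (R s) p
    inside′ (s , j) p m = let (q , m′ , p≡q∷z) = liftCopy⊆ (level s) (tile (T s) j) p m in
                          s , q , inside (T s) j q m′ , p≡q∷z

    cover′ : ∀ p → (Σ L λ s → AtLevel (level s) (R s) p) → ∃ λ i → InCopy (tile′ i) p
    cover′ p (s , q , r , refl) = let (j , m) = cover (T s) q r in
                                  (s , j) , liftCopy⊇ (level s) (tile (T s) j) p (q , m , refl)

    unique′ : ∀ p i i′ → InCopy (tile′ i) p → InCopy (tile′ i′) p → i ≡ i′
    unique′ p (s , j) (s′ , j′) m m′
      with liftCopy⊆ (level s) (tile (T s) j) p m | liftCopy⊆ (level s′) (tile (T s′) j′) p m′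
    ... | q , c , refl | q′ , c′ , e with ∷ʳ-injective q q′ e
    ... | refl , same-level with level-injective same-level
    ... | refl = cong (s ,_) (unique (T s) q j j′ c c′)

  tiling-columns : ∀ {d} (g : Fin k) → Tiling (λ p → ∃ λ q → Column {d} q g p) (Point k d)
  tiling-columns g = record
    { tile   = λ q → column q g
    ; inside = λ q p m → q , column⊆ q g p m
    ; cover  = λ p (q , c) → q , column⊇ q g p c
    ; unique = λ p q q′ m m′ → unique′ p q q′ (column⊆ q g p m) (column⊆ q′ g p m′)
    }
    where
    unique′ : ∀ p q q′ → Column q g p → Column q′ g p → q ≡ q′
    unique′ p q q′ (t , _ , refl) (t′ , _ , e) = ∷ʳ-injectiveˡ q q′ e

  tiling-column : ∀ {d} (q : Point k d) (g : Fin k) → Tiling (Column q g) ⊤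
  tiling-column q g = record
    { tile   = λ _ → column q g
    ; inside = λ _ → column⊆ q g
    ; cover  = λ p c → tt , column⊇ q g p c
    ; unique = λ _ _ _ _ _ → refl
    }

  Punctures : ℕ → Set
  Punctures zero    = ⊥
  Punctures (suc d) = Point k d ⊎ Punctures d

  finite-Punctures : (d : ℕ) → Finite (Punctures d)
  finite-Punctures zero    = finite-⊥
  finite-Punctures (suc d) = finite-⊎ (finite-Vec (finite-Fin k) d) (finite-Punctures d)

  -- Every single point is a hole: ℤ_k^d ∖ {a} is tiled.  Off the level of the
  -- last coordinate of a we use vertical lines, at that level we recurse.
  punctured : ∀ {d} (a : Point k d) → Tiling (λ p → ¬ p ≡ a) (Punctures d)
  punctured [] = record
    { tile = λ () ; inside = λ () ; cover = λ { [] a≢a → ⊥-elim (a≢a refl) } ; unique = λ _ () }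
  punctured {suc d} a with initLast a
  ... | as , al , refl =
    retile merge split (tiling-∪ disjoint (tiling-columns al) (tiling-lift al (punctured as)))
    where
    disjoint : ∀ p → (∃ λ q → Column q al p) → AtLevel al (λ q → ¬ q ≡ as) p → ⊥
    disjoint p (q , t , t≢al , refl) (q′ , _ , e) = t≢al (∷ʳ-injectiveʳ q q′ e)

    merge : ∀ p → (∃ λ q → Column q al p) ⊎ AtLevel al (λ q → ¬ q ≡ as) p → ¬ p ≡ as ∷ʳ al
    merge p (inj₁ (q , t , t≢al , refl)) e = t≢al (∷ʳ-injectiveʳ q as e)
    merge p (inj₂ (q , q≢as , refl))     e = q≢as (∷ʳ-injectiveˡ q as e)

    split : ∀ p → ¬ p ≡ as ∷ʳ al → (∃ λ q → Column q al p) ⊎ AtLevel al (λ q → ¬ q ≡ as) p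
    split p p≢a with initLast p
    ... | q , l , refl with l Fin.≟ al
    ...   | yes refl = inj₂ (q , (λ q≡as → p≢a (cong (_∷ʳ al) q≡as)) , refl)
    ...   | no  l≢al = inj₁ (q , l , l≢al , refl)

  hole⇒tiling : ∀ {d} {X : Subset k d} (h : IsHole k d X) → Tiling (λ p → ¬ X p) (Fin (proj₁ h))
  hole⇒tiling (m , C , disj , cov , uniq) = record
    { tile   = C
    ; inside = λ r p c Xp → disj p Xp r c
    ; cover  = cov
    ; unique = uniq
    }

  tiling⇒hole : ∀ {d} {X : Subset k d} {J} → Finite J → Tiling (λ p → ¬ X p) J → IsHole k d X
  tiling⇒hole (n , e) T =
    n , tile T′ , (λ p Xp r m → inside T′ r p m Xp) , cover T′ , unique T′
    where T′ = reindex e T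

-- The main construction, for k = k′ + 1 ≥ 2 so that levels are 0 or suc s
-- and the top level k-1 differs from 0.
module DaggerHole (k′ : ℕ) (1≤k′ : 1 ≤ k′) {d : ℕ} (X : Subset (suc k′) d)
                         (x : Point (suc k′) d) (Xx : X x) where

  k : ℕ
  k = suc k′

  top : Fin k
  top = topℤ k

  toℕ-top : toℕ top ≡ k′
  toℕ-top = trans (toℕ-fromℕ< _) (m<n⇒m%n≡m (n<1+n k′))

  -- Since k ≥ 2 the top level is not level 0, so the corner is not in X × {0}.
  top≢zero : ¬ top ≡ Fin.zero
  top≢zero top≡0 = <⇒≢ 1≤k′ (sym (trans (sym toℕ-top) (cong toℕ top≡0)))

  origin : Point k d
  origin = replicate d Fin.zero

  Y : Subset k (suc d)
  Y = dagger k d (remove X x)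

  -- The point missing from the tiled part of level l: the corner's base at
  -- the top level, x at the other levels (x is covered by the vertical line).
  missing : Fin k → Point k d
  missing l with l Fin.≟ top
  ... | yes _ = origin
  ... | no  _ = x

  missing-top : ∀ l → l ≡ top → missing l ≡ origin
  missing-top l l≡top with l Fin.≟ top
  ... | yes _     = refl
  ... | no  l≢top = ⊥-elim (l≢top l≡top)

  missing-other : ∀ l → ¬ l ≡ top → missing l ≡ x
  missing-other l l≢top with l Fin.≟ top
  ... | yes l≡top = ⊥-elim (l≢top l≡top)
  ... | no  _     = refl

  Vertical Ground Upper : Subset k (suc d)
  Vertical = Column x top
  Ground   = AtLevel Fin.zero (λ q → ¬ X q)
  Upper p  = Σ (Fin k′) λ s → AtLevel (Fin.suc s) (λ q → ¬ q ≡ missing (Fin.suc s)) p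

  Pieces : Subset k (suc d)
  Pieces p = Vertical p ⊎ (Ground p ⊎ Upper p)

  pieces⊆complement : ∀ p → Pieces p → ¬ Y p
  pieces⊆complement p (inj₁ (t , t≢top , refl)) (inj₁ (q , (_ , q≢x) , e)) = q≢x (sym (∷ʳ-injectiveˡ x q e))
  pieces⊆complement p (inj₁ (t , t≢top , refl)) (inj₂ e) = t≢top (∷ʳ-injectiveʳ x origin e)
  pieces⊆complement p (inj₂ (inj₁ (q , ¬Xq , refl))) (inj₁ (q′ , (Xq′ , _) , e)) =
    ¬Xq (subst X (sym (∷ʳ-injectiveˡ q q′ e)) Xq′)
  pieces⊆complement p (inj₂ (inj₁ (q , ¬Xq , refl))) (inj₂ e) = top≢zero (sym (∷ʳ-injectiveʳ q origin e))
  pieces⊆complement p (inj₂ (inj₂ (s , q , _ , refl))) (inj₁ (q′ , _ , e)) with ∷ʳ-injectiveʳ q q′ e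
  ... | ()
  pieces⊆complement p (inj₂ (inj₂ (s , q , q≢missing , refl))) (inj₂ e) with ∷ʳ-injective q origin e
  ... | q≡origin , s≡top = q≢missing (trans q≡origin (sym (missing-top (Fin.suc s) s≡top)))

  complement⊆pieces : ∀ p → ¬ Y p → Pieces p
  complement⊆pieces p ¬Yp with initLast p
  ... | q , l , refl = atLevel l ¬Yp
    where
    _≟ₚ_ : (a b : Point k d) → Dec (a ≡ b)
    _≟ₚ_ = ≡-dec Fin._≟_

    atLevel : ∀ l → ¬ Y (q ∷ʳ l) → Pieces (q ∷ʳ l)
    atLevel Fin.zero ¬Yp with q ≟ₚ x
    ... | yes refl = inj₁ (Fin.zero , (λ 0≡top → top≢zero (sym 0≡top)) , refl)
    ... | no  q≢x  = inj₂ (inj₁ (q , (λ Xq → ¬Yp (inj₁ (q , (Xq , q≢x) , refl))) , refl))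
    atLevel (Fin.suc s) ¬Yp with Fin.suc s Fin.≟ top
    ... | yes s≡top = inj₂ (inj₂ (s , q , q≢missing , refl))
      where
      q≢missing : ¬ q ≡ missing (Fin.suc s)
      q≢missing q≡missing = ¬Yp (inj₂ (cong₂ _∷ʳ_ (trans q≡missing (missing-top _ s≡top)) s≡top))
    ... | no s≢top with q ≟ₚ x
    ...   | yes refl = inj₁ (Fin.suc s , s≢top , refl)
    ...   | no  q≢x  = inj₂ (inj₂ (s , q , (λ q≡missing → q≢x (trans q≡missing (missing-other _ s≢top))) , refl))

  vertical-disjoint : ∀ p → Vertical p → Ground p ⊎ Upper p → ⊥
  vertical-disjoint p (t , t≢top , refl) (inj₁ (q , ¬Xq , e)) = ¬Xq (subst X (∷ʳ-injectiveˡ x q e) Xx)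
  vertical-disjoint p (t , t≢top , refl) (inj₂ (s , q , q≢missing , e)) with ∷ʳ-injective x q e
  ... | refl , refl = q≢missing (sym (missing-other (Fin.suc s) t≢top))

  ground-upper-disjoint : ∀ p → Ground p → Upper p → ⊥
  ground-upper-disjoint p (q , _ , refl) (s , q′ , _ , e) with ∷ʳ-injectiveʳ q q′ e
  ... | ()

  tiling-pieces : ∀ {J} → Tiling (λ q → ¬ X q) J → Tiling Pieces (⊤ ⊎ (J ⊎ (Fin k′ × Punctures d)))
  tiling-pieces T =
    tiling-∪ vertical-disjoint (tiling-column x top)
      (tiling-∪ ground-upper-disjoint (tiling-lift Fin.zero T)
        (tiling-levels Fin.suc suc-injective (λ s → punctured (missing (Fin.suc s)))))

  dagger-remove-hole : IsHole k d X → IsHole k (suc d) Y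
  dagger-remove-hole hole =
    tiling⇒hole index-finite
      (retile pieces⊆complement complement⊆pieces (tiling-pieces (hole⇒tiling hole)))
    where
    index-finite : Finite (⊤ ⊎ (Fin (proj₁ hole) ⊎ (Fin k′ × Punctures d)))
    index-finite = finite-⊎ finite-⊤ (finite-⊎ (finite-Fin _) (finite-× (finite-Fin k′) (finite-Punctures d)))

-- Proposition 5.  With copies of T being coordinate lines minus one point, the
-- argument only needs k ≥ 2 (so that the corner lies off level 0).
proposition5 : (k : ℕ) .{{_ : NonZero k}} → 3 ≤ k →
               (i : ℕ) → 2 ≤ i → i ≤ k ∸ 1 →
               (d : ℕ) → 1 ≤ d →
               (X : Subset k d) → IsHole k d X →
               (x : Point k d) → X x →
               IsHole k (Data.Nat.suc d) (dagger k d (remove X x))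
proposition5 (suc zero) (s≤s ()) _ _ _ _ _ _ _ _ _
proposition5 (suc k′@(suc _)) _ _ _ _ d _ X hole x Xx =
  DaggerHole.dagger-remove-hole k′ (s≤s z≤n) X x Xx hole
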